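{- Let $A$ be a finite nonempty set of agents. The functors $\kappa:\mathbf{SimCpx}_A\to\mathbf{PEFrame}^{\mathrm{proper}}_A$ and $\sigma:\mathbf{PEFrame}^{\mathrm{proper}}_A\to\mathbf{SimCpx}_A$ form an equivalence of categories between the category of proper partial epistemic frames over $A$ and the category of chromatic simplicial complexes coloured by $A$; i.e., $\kappa\circ\sigma$ and $\sigma\circ\kappa$ are naturally isomorphic to the respective identity functors.
   Context: $\mathbf{SimCpx}_A$: objects are chromatic simplicial complexes $\langle V,S,\chi\rangle$ (a family $S$ of nonempty subsets of $V$ containing all singletons, closed under nonempty subsets, with $\chi:V\to A$ giving distinct colours to vertices of each simplex), morphisms are chromatic simplicial maps (vertex maps preserving simplexes and colours). $\mathcal{F}(\mathcal{C})$ is the set of facets (maximal simplexes). $\mathbf{PEFrame}^{\mathrm{proper}}_A$: objects are proper partial epistemic frames $\langle W,\sim\rangle$, where each $\sim_a$ ($a\in A$) is symmetric and transitive, $\mathrm{live}(w)=\{a\mid w\sim_a w\}$, and proper means for all $w,w'$ there is $a$ with $w\sim_a w$ and ($w\neq w'\Rightarrow w\not\sim_a w'$). With $\mathrm{sat}_U(w)=\{w'\mid w\sim_a w'\ \forall a\in U\}$, morphisms $h:W\to\mathcal{P}(W')$ satisfy: $u\sim_a v$ implies $u'\sim'_a v'$ for all $u'\in h(u),v'\in h(v)$; and each $h(u)=\mathrm{sat}_{\mathrm{live}(u)}(u')$ for some $u'\in h(u)$. Composition: $(g\circ f)(u)=\mathrm{sat}_{\mathrm{live}(u)}(w)$ for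 any $v\in f(u)$, $w\in g(v)$. Functor $\kappa$: $\kappa(\mathcal{C})$ has worlds $\mathcal{F}(\mathcal{C})$ with $X\sim_a Y$ iff $a\in\chi(X\cap Y)$; $\kappa(f)(X)=\{Z\in\mathcal{F}(\mathcal{D})\mid f(X)\subseteq Z\}$. Functor $\sigma$: $\sigma(M)$ has vertices $v^w_a=(a,[w]_a)$ for $w\in W$, $a\in\mathrm{live}(w)$ (with $[w]_a$ the $\sim_a$-class), simplexes all nonempty subsets of $X_w=\{v^w_a\mid a\in\mathrm{live}(w)\}$, colouring $\chi(v^w_a)=a$; $\sigma(f)(v^w_a)=v^{w'}_a$ for any $w'\in f(w)$. -}

module Defs where

open import Level using (0ℓ)
open import Data.Product using (Σ; _×_; _,_; proj₁; proj₂)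
open import Data.List using (List; []; _∷_; map)
open import Data.List.Relation.Unary.Any using (Any)
open import Data.List.Relation.Unary.All using (All)
open import Relation.Binary.PropositionalEquality using (_≡_; _≢_)
open import Relation.Binary.Structures using (IsEquivalence)
open import Relation.Nullary using (¬_)

-- Finite subsets of a setoid, represented by lists (up to same elements)

Mem : {V : Set} → (V → V → Set) → V → List V → Set
Mem _≈_ x xs = Any (x ≈_) xs

Sub : {V : Set} → (V → V → Set) → List V → List V → Set
Sub _≈_ xs ys = ∀ x → Mem _≈_ x xs → Mem _≈_ x ys

record RawCpx (A : Set) : Set₁ where
  field
    V       : Set
    _≈_     : V → V → Set
    Simplex : List V → Set
    χ       : V → A

open RawCpx public

record IsCpx {A : Set} (C : RawCpx A) : Set where
  field
    isEquiv   : IsEquivalence (_≈_ C)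
    χ-resp    : ∀ {u v} → _≈_ C u v → χ C u ≡ χ C v
    nonempty  : ∀ {X} → Simplex C X → X ≢ []
    singleton : ∀ v → Simplex C (v ∷ [])
    downward  : ∀ {X Y} → Simplex C X → Y ≢ [] → Sub (_≈_ C) Y X → Simplex C Y
    chromatic : ∀ {X u v} → Simplex C X → Mem (_≈_ C) u X → Mem (_≈_ C) v X →
                χ C u ≡ χ C v → _≈_ C u v

Facet : {A : Set} (C : RawCpx A) → List (V C) → Set
Facet C X = Simplex C X × (∀ Y → Simplex C Y → Sub (_≈_ C) X Y → Sub (_≈_ C) Y X)

RawSimpMap : {A : Set} → RawCpx A → RawCpx A → Set
RawSimpMap C D = V C → V D

record IsSimpMap {A : Set} (C D : RawCpx A) (f : RawSimpMap C D) : Set where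
  field
    resp    : ∀ {u v} → _≈_ C u v → _≈_ D (f u) (f v)
    simplex : ∀ {X} → Simplex C X → Simplex D (map f X)
    colour  : ∀ v → χ D (f v) ≡ χ C v

EqS : {A : Set} (C D : RawCpx A) → RawSimpMap C D → RawSimpMap C D → Set
EqS C D f g = ∀ v → _≈_ D (f v) (g v)

idS : {A : Set} (C : RawCpx A) → RawSimpMap C C
idS C v = v

compS : {A : Set} (C D E : RawCpx A) → RawSimpMap D E → RawSimpMap C D → RawSimpMap C E
compS C D E g f v = g (f v)

IsoCpx : {A : Set} (C D : RawCpx A) → RawSimpMap C D → Set
IsoCpx C D f = IsSimpMap C D f ×
  Σ (RawSimpMap D C) λ g → IsSimpMap D C g ×
    EqS C C (compS C D C g f) (idS C) × EqS D D (compS D C D f g) (idS D)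

record RawFrame (A : Set) : Set₁ where
  field
    W  : Set
    _≃_ : W → W → Set
    R  : A → W → W → Set

open RawFrame public

live : {A : Set} (M : RawFrame A) → W M → A → Set
live M w a = R M a w w

Sat : {A : Set} (M : RawFrame A) → (A → Set) → W M → W M → Set
Sat M U w x = ∀ a → U a → R M a w x

record IsProperFrame {A : Set} (M : RawFrame A) : Set where
  field
    isEquiv : IsEquivalence (_≃_ M)
    R-resp  : ∀ {a w w' v v'} → _≃_ M w w' → _≃_ M v v' → R M a w v → R M a w' v'
    R-sym   : ∀ {a w v} → R M a w v → R M a v w
    R-trans : ∀ {a u v w} → R M a u v → R M a v w → R M a u w
    proper  : ∀ w w' → Σ A λ a → R M a w w × (¬ (_≃_ M w w') → ¬ (R M a w w'))

RawFrameMap : {A : Set} → RawFrame A → RawFrame A → Set₁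
RawFrameMap M M' = W M → W M' → Set

record IsFrameMap {A : Set} (M M' : RawFrame A) (h : RawFrameMap M M') : Set where
  field
    resp-dom : ∀ {u v x} → _≃_ M u v → h u x → h v x
    resp-cod : ∀ {u x y} → _≃_ M' x y → h u x → h u y
    pres     : ∀ {a u v u' v'} → R M a u v → h u u' → h v v' → R M' a u' v'
    rep      : ∀ u → Σ (W M') λ u' → h u u' ×
                 (∀ x → (h u x → Sat M' (live M u) u' x) × (Sat M' (live M u) u' x → h u x))

open IsFrameMap public

EqF : {A : Set} (M M' : RawFrame A) → RawFrameMap M M' → RawFrameMap M M' → Set
EqF M M' h g = ∀ u x → (h u x → g u x) × (g u x → h u x)

-- identity: u ↦ {u}  (= sat_{live u}(u) in a proper frame)
idF : {A : Set} (M : RawFrame A) → RawFrameMap M M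
idF M u x = _≃_ M u x

compF : {A : Set} (M M' M'' : RawFrame A) → RawFrameMap M' M'' → RawFrameMap M M' → RawFrameMap M M''
compF M M' M'' g f u x =
  Σ (W M') λ v → Σ (W M'') λ w → f u v × g v w × Sat M'' (live M u) w x

IsoFrame : {A : Set} (M M' : RawFrame A) → RawFrameMap M M' → Set₁
IsoFrame M M' h = IsFrameMap M M' h ×
  Σ (RawFrameMap M' M) λ g → IsFrameMap M' M g ×
    EqF M M (compF M M' M g h) (idF M) × EqF M' M' (compF M' M M' h g) (idF M')

κ : {A : Set} → RawCpx A → RawFrame A
κ C = record
  { W   = Σ (List (V C)) (Facet C)
  ; _≃_ = λ X Y → Sub (_≈_ C) (proj₁ X) (proj₁ Y) × Sub (_≈_ C) (proj₁ Y) (proj₁ X)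
  ; R   = λ a X Y → Σ (V C) λ v → Mem (_≈_ C) v (proj₁ X) × Mem (_≈_ C) v (proj₁ Y) × χ C v ≡ a
  }

κmap : {A : Set} (C D : RawCpx A) → RawSimpMap C D → RawFrameMap (κ C) (κ D)
κmap C D f X Z = Sub (_≈_ D) (map f (proj₁ X)) (proj₁ Z)

-- vertex v^w_a = (a , [w]_a), represented by (a , w , a ∈ live w),
-- with (a , w) = (b , w') iff a ≡ b and w ∼_a w'
σV : {A : Set} → RawFrame A → Set
σV {A} M = Σ A λ a → Σ (W M) λ w → R M a w w

σ : {A : Set} → RawFrame A → RawCpx A
σ {A} M = record
  { V       = σV M
  ; _≈_     = λ x y → (proj₁ x ≡ proj₁ y) × R M (proj₁ x) (proj₁ (proj₂ x)) (proj₁ (proj₂ y))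
  ; Simplex = λ L → (L ≢ []) ×
      Σ (W M) λ w → All (λ x → R M (proj₁ x) (proj₁ (proj₂ x)) w) L
  ; χ       = proj₁
  }

σmap : {A : Set} (M M' : RawFrame A) (h : RawFrameMap M M') → IsFrameMap M M' h →
       RawSimpMap (σ M) (σ M')
σmap M M' h hp (a , w , p) =
  a , proj₁ (rep hp w) , pres hp p (proj₁ (proj₂ (rep hp w))) (proj₁ (proj₂ (rep hp w)))

-- κ sends a complex to the frame of its facets, two facets being a-indistinguishable when they
-- share an a-coloured vertex; σ sends a frame to the complex whose vertices are the pairs (a , [w]ₐ)
-- and whose facets are the sets X_w of such pairs at a single world w.
--
-- Unit: w ↦ X_w. Properness says exactly that sat_{live w}(w) = {w}, so w is recovered from X_w,
-- and maximality forces every facet of σ M to be some X_w; the inverse is the graph of "the world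
-- of a facet". Counit: v ↦ (χ v , [F]_{χ v}) for any facet F ∋ v; since facets are chromatic, the
-- class does not depend on F, and the inverse (a , [X]ₐ) ↦ "the a-coloured vertex of X" is well
-- defined. A composite of frame maps can be computed at representatives, so naturality of the unit
-- reduces to σ(h)(X_u) ⊆ X_r for r ∈ h(u).
--
-- The argument is classical: a simplex is extended to a facet greedily, adding a vertex of each of
-- the finitely many colours when possible, and building X_w decides which agents are live at w.
module Submission where

open import Defs
open import Level using (0ℓ)
open import Axiom.ExcludedMiddle using (ExcludedMiddle)
open import Function using (_∘_)
open import Data.Nat using (ℕ; suc)
open import Data.Fin using (Fin)
open import Data.Product using (Σ; _×_; _,_; proj₁; proj₂)
open import Data.Empty using (⊥-elim)
open import Data.List using (List; []; _∷_; map; allFin)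
open import Data.List.Relation.Unary.Any using (Any; here; there)
open import Data.List.Relation.Unary.All using (All; []; _∷_; tabulateₛ; lookupₛ)
import Data.List.Relation.Unary.All as All
import Data.List.Relation.Unary.All.Properties as All
open import Data.List.Relation.Unary.Enumerates.Setoid using (IsEnumeration)
import Data.List.Membership.Propositional as Propositional
open import Data.List.Membership.Propositional.Properties using (∈-allFin)
import Data.List.Membership.Setoid as SetoidMembership
open import Data.List.Membership.Setoid.Properties using (∈-resp-≈; ∈-map⁺; ∈-map⁻)
open import Relation.Binary.Bundles using (Setoid)
open import Relation.Binary.Structures using (IsEquivalence)
open import Relation.Binary.PropositionalEquality using (_≡_; _≢_; refl)
  renaming (sym to ≡-sym; trans to ≡-trans; setoid to ≡-setoid)
open import Relation.Nullary using (¬_; yes; no)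

Any⇒≢[] : {V : Set} {P : V → Set} {xs : List V} → Any P xs → xs ≢ []
Any⇒≢[] (here _)  ()
Any⇒≢[] (there _) ()

map-≢[] : {V U : Set} (f : V → U) {xs : List V} → xs ≢ [] → map f xs ≢ []
map-≢[] f {[]}    xs≢[] = λ _ → xs≢[] refl
map-≢[] f {_ ∷ _} _     ()

module ProperFrame {A : Set} {M : RawFrame A} (pM : IsProperFrame M) where
  open IsProperFrame pM public
  open IsEquivalence isEquiv public using ()
    renaming (refl to ≃-refl; sym to ≃-sym; trans to ≃-trans)

module _ {A : Set} where

  SatSeparated : RawFrame A → Set
  SatSeparated M = ∀ w w' → Sat M (live M w) w w' → _≃_ M w w'

  proper⇒satSeparated : ExcludedMiddle 0ℓ → {M : RawFrame A} → IsProperFrame M → SatSeparated M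
  proper⇒satSeparated em {M} pM w w' s with em {_≃_ M w w'}
  ... | yes w≃w' = w≃w'
  ... | no w≄w' with IsProperFrame.proper pM w w'
  ...   | a , l , separates = ⊥-elim (separates w≄w' (s a l))

  satSeparated⇒proper : ExcludedMiddle 0ℓ → (M : RawFrame A) → (∀ w → Σ A (live M w)) →
    SatSeparated M → ∀ w w' → Σ A λ a → R M a w w × (¬ _≃_ M w w' → ¬ R M a w w')
  satSeparated⇒proper em M someLive separated w w'
    with em {Σ A λ a → live M w a × ¬ R M a w w'}
  ... | yes (a , l , ¬r) = a , l , λ _ → ¬r
  ... | no noneSeparates = proj₁ (someLive w) , proj₂ (someLive w) ,
                           λ w≄w' _ → w≄w' (separated w w' everyLiveRelates)
    where
    everyLiveRelates : Sat M (live M w) w w'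
    everyLiveRelates b lb with em {R M b w w'}
    ... | yes r = r
    ... | no ¬r = ⊥-elim (noneSeparates (b , lb , ¬r))

  graph : (M M' : RawFrame A) → (W M → W M') → RawFrameMap M M'
  graph M M' φ u x = _≃_ M' (φ u) x

  module _ (M M' : RawFrame A) (φ : W M → W M') where

    graph-isFrameMap : IsProperFrame M' → SatSeparated M' →
      (∀ {u v} → _≃_ M u v → _≃_ M' (φ u) (φ v)) →
      (∀ {a u v} → R M a u v → R M' a (φ u) (φ v)) →
      (∀ {a u} → live M' (φ u) a → live M u a) →
      IsFrameMap M M' (graph M M' φ)
    graph-isFrameMap pM' separated φ-resp φ-R φ-live = record
      { resp-dom = λ u≃v φu≃x → ≃-trans (≃-sym (φ-resp u≃v)) φu≃x
      ; resp-cod = λ x≃y φu≃x → ≃-trans φu≃x x≃y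
      ; pres     = λ r φu≃u' φv≃v' → R-resp φu≃u' φv≃v' (φ-R r)
      ; rep      = λ u → φ u , ≃-refl , λ x →
          (λ φu≃x a l → R-resp ≃-refl φu≃x (φ-R l)) ,
          (λ s → separated (φ u) x (λ a l → s a (φ-live l)))
      }
      where open ProperFrame pM'

    graph-inverse : (ψ : W M' → W M) → IsProperFrame M → IsProperFrame M' → SatSeparated M →
      (∀ {x y} → _≃_ M' x y → _≃_ M (ψ x) (ψ y)) → (∀ u → _≃_ M (ψ (φ u)) u) →
      EqF M M (compF M M' M (graph M' M ψ) (graph M M' φ)) (idF M)
    graph-inverse ψ pM pM' separated ψ-resp ψφ≃id u x = to , from
      where
      open ProperFrame pM
      to : compF M M' M (graph M' M ψ) (graph M M' φ) u x → _≃_ M u x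
      to (v , w , φu≃v , ψv≃w , s) = separated u x λ a l → R-resp (≃-sym u≃w) ≃-refl (s a l)
        where u≃w = ≃-trans (≃-sym (ψφ≃id u)) (≃-trans (ψ-resp φu≃v) ψv≃w)
      from : _≃_ M u x → compF M M' M (graph M' M ψ) (graph M M' φ) u x
      from u≃x = φ u , ψ (φ u) , ProperFrame.≃-refl pM' , ≃-refl ,
                 λ a l → R-resp (≃-sym (ψφ≃id u)) u≃x l

  compF⇔Sat : {M M' M'' : RawFrame A} {f : RawFrameMap M M'} {g : RawFrameMap M' M''} →
    IsFrameMap M M' f → IsFrameMap M' M'' g → IsProperFrame M'' →
    ∀ {u v w} → f u v → g v w → ∀ x →
    (compF M M' M'' g f u x → Sat M'' (live M u) w x) ×
    (Sat M'' (live M u) w x → compF M M' M'' g f u x)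
  compF⇔Sat fp gp pM'' {u} {v} {w} fuv gvw x =
    (λ (v' , w' , fuv' , gv'w' , s) a l → R-trans (pres gp (pres fp l fuv fuv') gvw gv'w') (s a l)) ,
    (λ s → v , w , fuv , gvw , s)
    where open ProperFrame pM''

  representative : {M M' : RawFrame A} {h : RawFrameMap M M'} → IsFrameMap M M' h → W M → W M'
  representative hp u = proj₁ (rep hp u)

  representative-∈ : {M M' : RawFrame A} {h : RawFrameMap M M'} (hp : IsFrameMap M M' h) →
    ∀ u → h u (representative hp u)
  representative-∈ hp u = proj₁ (proj₂ (rep hp u))

module Complex {A : Set} (C : RawCpx A) (pC : IsCpx C) where
  open IsCpx pC public

  setoid : Setoid 0ℓ 0ℓ
  setoid = record { Carrier = V C ; _≈_ = _≈_ C ; isEquivalence = isEquiv }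

  open Setoid setoid public using () renaming (refl to ≈-refl; sym to ≈-sym)
  open SetoidMembership setoid public using (_∈_)

  _≋_ : List (V C) → List (V C) → Set
  xs ≋ ys = Sub (_≈_ C) xs ys × Sub (_≈_ C) ys xs

  ≋-refl : ∀ {xs} → xs ≋ xs
  ≋-refl = (λ _ x∈ → x∈) , (λ _ x∈ → x∈)

  ≋-sym : ∀ {xs ys} → xs ≋ ys → ys ≋ xs
  ≋-sym (xs⊆ys , ys⊆xs) = ys⊆xs , xs⊆ys

  ≋-trans : ∀ {xs ys zs} → xs ≋ ys → ys ≋ zs → xs ≋ zs
  ≋-trans (xs⊆ys , ys⊆xs) (ys⊆zs , zs⊆ys) =
    (λ x → ys⊆zs x ∘ xs⊆ys x) , (λ x → ys⊆xs x ∘ zs⊆ys x)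

  facet-chromatic : (X : W (κ C)) → ∀ {u v} → u ∈ proj₁ X → v ∈ proj₁ X →
    χ C u ≡ χ C v → _≈_ C u v
  facet-chromatic (_ , sX , _) = chromatic sX

  ∈-facet-colour : (X : W (κ C)) → ∀ {u v} → u ∈ proj₁ X → v ∈ proj₁ X → χ C u ≡ χ C v →
    ∀ {ys} → v ∈ ys → u ∈ ys
  ∈-facet-colour X u∈X v∈X χu≡χv = ∈-resp-≈ setoid (≈-sym (facet-chromatic X u∈X v∈X χu≡χv))

  κ-satSeparated : SatSeparated (κ C)
  κ-satSeparated X Y s = X⊆Y , proj₂ (proj₂ X) (proj₁ Y) (proj₁ (proj₂ Y)) X⊆Y
    where
    X⊆Y : Sub (_≈_ C) (proj₁ X) (proj₁ Y)
    X⊆Y x x∈X with s (χ C x) (x , x∈X , x∈X , refl)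
    ... | y , y∈X , y∈Y , χy≡χx = ∈-facet-colour X x∈X y∈X (≡-sym χy≡χx) y∈Y

  κ-someLive : ∀ X → Σ A (live (κ C) X)
  κ-someLive ([] , sX , _)    = ⊥-elim (nonempty sX refl)
  κ-someLive (x ∷ _ , _ , _) = χ C x , x , here ≈-refl , here ≈-refl , refl

  κ-R-trans : ∀ {a} X Y Z → R (κ C) a X Y → R (κ C) a Y Z → R (κ C) a X Z
  κ-R-trans _ Y _ (x , x∈X , x∈Y , χx) (y , y∈Y , y∈Z , χy) =
    x , x∈X , ∈-facet-colour Y x∈Y y∈Y (≡-trans χx (≡-sym χy)) y∈Z , χx

  κ-isProper : ExcludedMiddle 0ℓ → IsProperFrame (κ C)
  κ-isProper em = record
    { isEquiv = record { refl = ≋-refl ; sym = ≋-sym ; trans = ≋-trans }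
    ; R-resp  = λ (X⊆X' , _) (Y⊆Y' , _) (v , v∈X , v∈Y , χv) → v , X⊆X' v v∈X , Y⊆Y' v v∈Y , χv
    ; R-sym   = λ (v , v∈X , v∈Y , χv) → v , v∈Y , v∈X , χv
    ; R-trans = λ {_} {X} {Y} {Z} → κ-R-trans X Y Z
    ; proper  = satSeparated⇒proper em (κ C) κ-someLive κ-satSeparated
    }

  module Extension (em : ExcludedMiddle 0ℓ)
                   (agents : List A) (agents-enum : IsEnumeration (≡-setoid A) agents) where

    SaturatedIn : A → List (V C) → Set
    SaturatedIn a Y = ∀ Z → Simplex C Z → Sub (_≈_ C) Y Z → ∀ z → z ∈ Z → χ C z ≡ a → z ∈ Y

    Extensible : A → List (V C) → Set
    Extensible a X = Σ (V C) λ v → χ C v ≡ a × Simplex C (v ∷ X)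

    addColour : A → List (V C) → List (V C)
    addColour a X with em {Extensible a X}
    ... | yes (v , _) = v ∷ X
    ... | no _        = X

    addColour-simplex : ∀ a {X} → Simplex C X → Simplex C (addColour a X)
    addColour-simplex a {X} sX with em {Extensible a X}
    ... | yes (_ , _ , s) = s
    ... | no _            = sX

    ⊆-addColour : ∀ a X → Sub (_≈_ C) X (addColour a X)
    ⊆-addColour a X with em {Extensible a X}
    ... | yes _ = λ _ → there
    ... | no _  = λ _ x∈X → x∈X

    addColour-saturated : ∀ a X → SaturatedIn a (addColour a X)
    addColour-saturated a X with em {Extensible a X}
    ... | yes (v , χv , _) = λ Z sZ v∷X⊆Z z z∈Z χz →
      here (chromatic sZ z∈Z (v∷X⊆Z v (here ≈-refl)) (≡-trans χz (≡-sym χv)))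
    ... | no ¬extensible = λ Z sZ X⊆Z z z∈Z χz →
      ⊥-elim (¬extensible (z , χz , downward sZ (λ ()) λ where
        y (here y≈z)  → ∈-resp-≈ setoid (≈-sym y≈z) z∈Z
        y (there y∈X) → X⊆Z y y∈X))

    saturatedIn-mono : ∀ {a Y Y'} → Sub (_≈_ C) Y Y' → SaturatedIn a Y → SaturatedIn a Y'
    saturatedIn-mono Y⊆Y' satY Z sZ Y'⊆Z z z∈Z χz =
      Y⊆Y' z (satY Z sZ (λ y → Y'⊆Z y ∘ Y⊆Y' y) z z∈Z χz)

    saturate : List A → List (V C) → List (V C)
    saturate []       X = X
    saturate (a ∷ as) X = saturate as (addColour a X)

    saturate-simplex : ∀ as {X} → Simplex C X → Simplex C (saturate as X)
    saturate-simplex []       sX = sX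
    saturate-simplex (a ∷ as) sX = saturate-simplex as (addColour-simplex a sX)

    ⊆-saturate : ∀ as X → Sub (_≈_ C) X (saturate as X)
    ⊆-saturate []       X = λ _ x∈X → x∈X
    ⊆-saturate (a ∷ as) X = λ x → ⊆-saturate as (addColour a X) x ∘ ⊆-addColour a X x

    saturate-saturated : ∀ {a} as X → a Propositional.∈ as → SaturatedIn a (saturate as X)
    saturate-saturated (a ∷ as) X (here refl) =
      saturatedIn-mono (⊆-saturate as (addColour a X)) (addColour-saturated a X)
    saturate-saturated (_ ∷ as) X (there a∈as) = saturate-saturated as _ a∈as

    extendToFacet : ∀ X → Simplex C X → Σ (W (κ C)) λ F → Sub (_≈_ C) X (proj₁ F)
    extendToFacet X sX =
      (saturate agents X , saturate-simplex agents sX , maximal) , ⊆-saturate agents X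
      where
      maximal : ∀ Z → Simplex C Z → Sub (_≈_ C) (saturate agents X) Z →
        Sub (_≈_ C) Z (saturate agents X)
      maximal Z sZ ⊆Z z z∈Z = saturate-saturated agents X (agents-enum (χ C z)) Z sZ ⊆Z z z∈Z refl

module _ {A : Set} {C D : RawCpx A} (pC : IsCpx C) (pD : IsCpx D)
         {f : RawSimpMap C D} (fp : IsSimpMap C D f) where
  private
    module CC = Complex C pC
    module DC = Complex D pD
  open IsSimpMap fp

  ∈-map-simpMap : ∀ {x X} → x CC.∈ X → f x DC.∈ map f X
  ∈-map-simpMap = ∈-map⁺ CC.setoid DC.setoid resp

  κmap-resp-dom : ∀ {X Y Z} → _≃_ (κ C) X Y → κmap C D f X Z → κmap C D f Y Z
  κmap-resp-dom {X} {Y} {Z} (_ , Y⊆X) fX⊆Z y y∈fY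
    with ∈-map⁻ CC.setoid DC.setoid {xs = proj₁ Y} y∈fY
  ... | x , x∈Y , y≈fx =
    ∈-resp-≈ DC.setoid (DC.≈-sym y≈fx) (fX⊆Z (f x) (∈-map-simpMap (Y⊆X x x∈Y)))

  module _ (em : ExcludedMiddle 0ℓ)
           (agents : List A) (agents-enum : IsEnumeration (≡-setoid A) agents) where

    κmap-rep : (X : W (κ C)) → Σ (W (κ D)) λ F → κmap C D f X F × (∀ Z →
      (κmap C D f X Z → Sat (κ D) (live (κ C) X) F Z) ×
      (Sat (κ D) (live (κ C) X) F Z → κmap C D f X Z))
    κmap-rep X@(xs , sX , _) = F , fX⊆F , λ Z → to Z , from Z
      where
      open DC.Extension em agents agents-enum
      F = proj₁ (extendToFacet (map f xs) (simplex sX))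
      fX⊆F = proj₂ (extendToFacet (map f xs) (simplex sX))
      to : ∀ Z → Sub (_≈_ D) (map f xs) (proj₁ Z) → Sat (κ D) (live (κ C) X) F Z
      to Z fX⊆Z a (x , x∈X , _ , χx) =
        f x , fX⊆F (f x) (∈-map-simpMap x∈X) , fX⊆Z (f x) (∈-map-simpMap x∈X) ,
        ≡-trans (colour x) χx
      from : ∀ Z → Sat (κ D) (live (κ C) X) F Z → Sub (_≈_ D) (map f xs) (proj₁ Z)
      from Z s y y∈fX with ∈-map⁻ CC.setoid DC.setoid {xs = xs} y∈fX
      ... | x , x∈X , y≈fx with s (χ C x) (x , x∈X , x∈X , refl)
      ... | z , z∈F , z∈Z , χz = ∈-resp-≈ DC.setoid (DC.≈-sym y≈fx)
            (DC.∈-facet-colour F (fX⊆F (f x) (∈-map-simpMap x∈X)) z∈F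
              (≡-trans (colour x) (≡-sym χz)) z∈Z)

    κmap-isFrameMap : IsFrameMap (κ C) (κ D) (κmap C D f)
    κmap-isFrameMap = record
      { resp-dom = λ {X} {Y} {Z} → κmap-resp-dom {X} {Y} {Z}
      ; resp-cod = λ (Z⊆Z' , _) fX⊆Z y → Z⊆Z' y ∘ fX⊆Z y
      ; pres     = λ (x , x∈X , x∈Y , χx) fX⊆X' fY⊆Y' →
          f x , fX⊆X' (f x) (∈-map-simpMap x∈X) , fY⊆Y' (f x) (∈-map-simpMap x∈Y) ,
          ≡-trans (colour x) χx
      ; rep      = κmap-rep
      }

module Sigma {A : Set} (M : RawFrame A) (pM : IsProperFrame M) where
  open ProperFrame pM

  -- x = (a , w' , _) stands for the vertex (a , [w']ₐ); it lies on X_w iff w' ∼ₐ w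
  InWorld : W M → σV M → Set
  InWorld w x = R M (proj₁ x) (proj₁ (proj₂ x)) w

  setoid : Setoid 0ℓ 0ℓ
  setoid = record
    { Carrier       = σV M
    ; _≈_           = _≈_ (σ M)
    ; isEquivalence = record
      { refl  = λ {x} → refl , proj₂ (proj₂ x)
      ; sym   = λ { (refl , r) → refl , R-sym r }
      ; trans = λ { (refl , r) (refl , r') → refl , R-trans r r' }
      }
    }

  open Setoid setoid public using () renaming (refl to ≈-refl; sym to ≈-sym)
  open SetoidMembership setoid public using (_∈_)

  InWorld-resp : ∀ {w} x y → _≈_ (σ M) x y → InWorld w x → InWorld w y
  InWorld-resp _ _ (refl , r) = R-trans (R-sym r)

  InWorld-lookup : ∀ {w xs} → All (InWorld w) xs → ∀ x → x ∈ xs → InWorld w x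
  InWorld-lookup xs∈w x = lookupₛ setoid (λ {x} {y} → InWorld-resp x y) xs∈w {x}

  InWorld-≈ : ∀ {w} x y → InWorld w x → InWorld w y → proj₁ x ≡ proj₁ y → _≈_ (σ M) x y
  InWorld-≈ _ _ x∈w y∈w refl = refl , R-trans x∈w (R-sym y∈w)

  σ-isCpx : IsCpx (σ M)
  σ-isCpx = record
    { isEquiv   = Setoid.isEquivalence setoid
    ; χ-resp    = proj₁
    ; nonempty  = proj₁
    ; singleton = λ (a , w , l) → (λ ()) , w , l ∷ []
    ; downward  = λ (_ , w , X∈w) Y≢[] Y⊆X →
        Y≢[] , w , tabulateₛ setoid λ {y} y∈Y → InWorld-lookup X∈w y (Y⊆X y y∈Y)
    ; chromatic = λ { {u = u} {v} (_ , w , X∈w) u∈X v∈X →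
        InWorld-≈ u v (InWorld-lookup X∈w u u∈X) (InWorld-lookup X∈w v v∈X) }
    }

module _ {A : Set} {M M' : RawFrame A} (pM : IsProperFrame M) (pM' : IsProperFrame M')
         {h : RawFrameMap M M'} (hp : IsFrameMap M M' h) where
  private
    module SM  = Sigma M pM
    module SM' = Sigma M' pM'

  σmap-InWorld : ∀ {w} x → SM.InWorld w x → SM'.InWorld (representative hp w) (σmap M M' h hp x)
  σmap-InWorld {w} (_ , w' , _) x∈w = pres hp x∈w (representative-∈ hp w') (representative-∈ hp w)

  σmap-isSimpMap : IsSimpMap (σ M) (σ M') (σmap M M' h hp)
  σmap-isSimpMap = record
    { resp    = λ { {_ , w , _} {_ , w' , _} (refl , r) →
                    refl , pres hp r (representative-∈ hp w) (representative-∈ hp w') }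
    ; simplex = λ (X≢[] , w , X∈w) →
        map-≢[] _ X≢[] , representative hp w , All.map⁺ (All.map (λ {x} → σmap-InWorld x) X∈w)
    ; colour  = λ _ → refl
    }

module Unit {A : Set} (em : ExcludedMiddle 0ℓ)
            (agents : List A) (agents-enum : IsEnumeration (≡-setoid A) agents)
            (M : RawFrame A) (pM : IsProperFrame M) where
  open ProperFrame pM
  open Sigma M pM
  module KC = Complex (σ M) σ-isCpx

  K : RawFrame A
  K = κ (σ M)

  pK : IsProperFrame K
  pK = KC.κ-isProper em

  liveVertices : W M → List A → List (σV M)
  liveVertices u []       = []
  liveVertices u (a ∷ as) with em {live M u a}
  ... | yes l = (a , u , l) ∷ liveVertices u as
  ... | no _  = liveVertices u as

  liveVertices-InWorld : ∀ u as → All (InWorld u) (liveVertices u as)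
  liveVertices-InWorld u []       = []
  liveVertices-InWorld u (a ∷ as) with em {live M u a}
  ... | yes l = l ∷ liveVertices-InWorld u as
  ... | no _  = liveVertices-InWorld u as

  ∈-liveVertices : ∀ u {a} (l : live M u a) as → a Propositional.∈ as →
    (a , u , l) ∈ liveVertices u as
  ∈-liveVertices u l (b ∷ as) a∈b∷as with em {live M u b} | a∈b∷as
  ... | yes _ | here refl  = here (refl , l)
  ... | yes _ | there a∈as = there (∈-liveVertices u l as a∈as)
  ... | no ¬l | here refl  = ⊥-elim (¬l l)
  ... | no _  | there a∈as = ∈-liveVertices u l as a∈as

  worldSimplex : W M → List (σV M)
  worldSimplex u = liveVertices u agents

  worldSimplex-InWorld : ∀ u x → x ∈ worldSimplex u → InWorld u x
  worldSimplex-InWorld u = InWorld-lookup (liveVertices-InWorld u agents)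

  InWorld⇒∈worldSimplex : ∀ {u} x → InWorld u x → x ∈ worldSimplex u
  InWorld⇒∈worldSimplex {u} x@(a , _ , _) x∈u =
    ∈-resp-≈ setoid {x = a , u , l} {x} (refl , R-sym x∈u) (∈-liveVertices u l agents (agents-enum a))
    where l = R-trans (R-sym x∈u) x∈u

  worldSimplex-isSimplex : ∀ u → Simplex (σ M) (worldSimplex u)
  worldSimplex-isSimplex u with proper u u
  ... | a , l , _ =
    Any⇒≢[] (InWorld⇒∈worldSimplex (a , u , l) l) , u , liveVertices-InWorld u agents

  ⊆worldSimplex⇒≃ : ∀ {u w} → Sub (_≈_ (σ M)) (worldSimplex u) (worldSimplex w) → _≃_ M u w
  ⊆worldSimplex⇒≃ {u} {w} Xu⊆Xw = proper⇒satSeparated em pM u w λ a l →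
    worldSimplex-InWorld w (a , u , l) (Xu⊆Xw (a , u , l) (InWorld⇒∈worldSimplex (a , u , l) l))

  worldSimplex-isFacet : ∀ u → Facet (σ M) (worldSimplex u)
  worldSimplex-isFacet u = worldSimplex-isSimplex u , λ where
    Y (_ , w , Y∈w) Xu⊆Y y y∈Y →
      let Xu⊆Xw = λ x x∈Xu → InWorld⇒∈worldSimplex x (InWorld-lookup Y∈w x (Xu⊆Y x x∈Xu))
      in InWorld⇒∈worldSimplex y
           (R-resp ≃-refl (≃-sym (⊆worldSimplex⇒≃ Xu⊆Xw)) (InWorld-lookup Y∈w y y∈Y))

  worldFacet : W M → W K
  worldFacet u = worldSimplex u , worldSimplex-isFacet u

  worldOf : W K → W M
  worldOf (_ , (_ , w , _) , _) = w

  worldOf-InWorld : ∀ Y x → x ∈ proj₁ Y → InWorld (worldOf Y) x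
  worldOf-InWorld (_ , (_ , _ , Y∈w) , _) = InWorld-lookup Y∈w

  worldFacet-worldOf : ∀ Y → _≃_ K (worldFacet (worldOf Y)) Y
  worldFacet-worldOf Y = proj₂ (proj₂ Y) (worldSimplex w) (worldSimplex-isSimplex w) Y⊆Xw , Y⊆Xw
    where
    w = worldOf Y
    Y⊆Xw : Sub (_≈_ (σ M)) (proj₁ Y) (worldSimplex w)
    Y⊆Xw y y∈Y = InWorld⇒∈worldSimplex y (worldOf-InWorld Y y y∈Y)

  worldFacet-injective : ∀ {u w} → _≃_ K (worldFacet u) (worldFacet w) → _≃_ M u w
  worldFacet-injective = ⊆worldSimplex⇒≃ ∘ proj₁

  worldFacet-resp : ∀ {u w} → _≃_ M u w → _≃_ K (worldFacet u) (worldFacet w)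
  worldFacet-resp u≃w = transport u≃w , transport (≃-sym u≃w)
    where
    transport : ∀ {u w} → _≃_ M u w → Sub (_≈_ (σ M)) (worldSimplex u) (worldSimplex w)
    transport {u} u≃w x x∈Xu =
      InWorld⇒∈worldSimplex x (R-resp ≃-refl u≃w (worldSimplex-InWorld u x x∈Xu))

  R-shared : ∀ {u v} x → InWorld u x → InWorld v x → R M (proj₁ x) u v
  R-shared _ x∈u x∈v = R-trans (R-sym x∈u) x∈v

  worldFacet-R : ∀ {a u v} → R M a u v → R K a (worldFacet u) (worldFacet v)
  worldFacet-R {a} {u} r =
    x , InWorld⇒∈worldSimplex x (R-trans r (R-sym r)) , InWorld⇒∈worldSimplex x r , refl
    where x = a , u , R-trans r (R-sym r)

  worldFacet-R⁻ : ∀ {a u v} → R K a (worldFacet u) (worldFacet v) → R M a u v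
  worldFacet-R⁻ {u = u} {v} (x , x∈Xu , x∈Xv , refl) =
    R-shared x (worldSimplex-InWorld u x x∈Xu) (worldSimplex-InWorld v x x∈Xv)

  worldOf-resp : ∀ {Y Y'} → _≃_ K Y Y' → _≃_ M (worldOf Y) (worldOf Y')
  worldOf-resp {Y} {Y'} Y≃Y' = worldFacet-injective
    (KC.≋-trans (worldFacet-worldOf Y) (KC.≋-trans Y≃Y' (KC.≋-sym (worldFacet-worldOf Y'))))

  worldOf-R : ∀ {a Y Y'} → R K a Y Y' → R M a (worldOf Y) (worldOf Y')
  worldOf-R {Y = Y} {Y'} (x , x∈Y , x∈Y' , refl) =
    R-shared x (worldOf-InWorld Y x x∈Y) (worldOf-InWorld Y' x x∈Y')

  worldOf-live : ∀ {a Y} → live M (worldOf Y) a → live K Y a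
  worldOf-live {a} {Y} l = x , x∈Y , x∈Y , refl
    where
    x = a , worldOf Y , l
    x∈Y = proj₁ (worldFacet-worldOf Y) x (InWorld⇒∈worldSimplex x l)

  worldFacet-isFrameMap : IsFrameMap M K (graph M K worldFacet)
  worldFacet-isFrameMap =
    graph-isFrameMap M K worldFacet pK KC.κ-satSeparated worldFacet-resp worldFacet-R worldFacet-R⁻

  worldOf-isFrameMap : IsFrameMap K M (graph K M worldOf)
  worldOf-isFrameMap = graph-isFrameMap K M worldOf pM (proper⇒satSeparated em pM)
    (λ {Y} {Y'} → worldOf-resp {Y} {Y'}) (λ {a} {Y} {Y'} → worldOf-R {a} {Y} {Y'})
    (λ {a} {Y} → worldOf-live {a} {Y})

  worldFacet-isIso : IsoFrame M K (graph M K worldFacet)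
  worldFacet-isIso = worldFacet-isFrameMap , graph K M worldOf , worldOf-isFrameMap ,
    graph-inverse M K worldFacet worldOf pM pK (proper⇒satSeparated em pM)
      (λ {Y} {Y'} → worldOf-resp {Y} {Y'}) (λ _ → ≃-refl) ,
    graph-inverse K M worldOf worldFacet pK pM KC.κ-satSeparated worldFacet-resp worldFacet-worldOf

module _ {A : Set} (em : ExcludedMiddle 0ℓ)
         (agents : List A) (agents-enum : IsEnumeration (≡-setoid A) agents)
         {M M' : RawFrame A} (pM : IsProperFrame M) (pM' : IsProperFrame M')
         {h : RawFrameMap M M'} (hp : IsFrameMap M M' h) where
  private
    module U  = Unit em agents agents-enum M pM
    module U' = Unit em agents agents-enum M' pM'
    σh = σmap M M' h hp

  σmap-worldSimplex : ∀ u →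
    Sub (_≈_ (σ M')) (map σh (U.worldSimplex u)) (U'.worldSimplex (representative hp u))
  σmap-worldSimplex u y y∈σXu
    with ∈-map⁻ (Sigma.setoid M pM) (Sigma.setoid M' pM') {y} {U.worldSimplex u} {σh} y∈σXu
  ... | x , x∈Xu , y≈σx = U'.InWorld⇒∈worldSimplex {representative hp u} y
        (Sigma.InWorld-resp M' pM' (σh x) y (Sigma.≈-sym M' pM' {y} {σh x} y≈σx)
          (σmap-InWorld pM pM' hp x (U.worldSimplex-InWorld u x x∈Xu)))

  -- both composites equal sat_{live u} of the facet X_r, r the representative of h(u)
  worldFacet-natural :
    EqF M (κ (σ M'))
      (compF M M' (κ (σ M')) (graph M' (κ (σ M')) U'.worldFacet) h)
      (compF M (κ (σ M)) (κ (σ M')) (κmap (σ M) (σ M') σh) (graph M (κ (σ M)) U.worldFacet))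
  worldFacet-natural u X = proj₂ viaσh ∘ proj₁ viah , proj₂ viah ∘ proj₁ viaσh
    where
    r = representative hp u
    σh-isFrameMap = κmap-isFrameMap (Sigma.σ-isCpx M pM) (Sigma.σ-isCpx M' pM')
                      (σmap-isSimpMap pM pM' hp) em agents agents-enum
    viah = compF⇔Sat hp U'.worldFacet-isFrameMap U'.pK {u} {r} {U'.worldFacet r}
             (representative-∈ hp u) U'.KC.≋-refl X
    viaσh = compF⇔Sat U.worldFacet-isFrameMap σh-isFrameMap U'.pK {u} {U.worldFacet u} {U'.worldFacet r}
              U.KC.≋-refl (σmap-worldSimplex u) X

module Counit {A : Set} (em : ExcludedMiddle 0ℓ)
              (agents : List A) (agents-enum : IsEnumeration (≡-setoid A) agents)
              (C : RawCpx A) (pC : IsCpx C) where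
  open Complex C pC
  open Extension em agents agents-enum
  private
    module SK = Sigma (κ C) (κ-isProper em)

  facetOf : V C → W (κ C)
  facetOf v = proj₁ (extendToFacet (v ∷ []) (singleton v))

  ∈-facetOf : ∀ v → v ∈ proj₁ (facetOf v)
  ∈-facetOf v = proj₂ (extendToFacet (v ∷ []) (singleton v)) v (here ≈-refl)

  ε : RawSimpMap C (σ (κ C))
  ε v = χ C v , facetOf v , v , ∈-facetOf v , ∈-facetOf v , refl

  ε-simplex : ∀ {X} → Simplex C X → Simplex (σ (κ C)) (map ε X)
  ε-simplex {X} sX = map-≢[] ε (nonempty sX) , F ,
    All.map⁺ (tabulateₛ setoid {P = SK.InWorld F ∘ ε} λ {x} x∈X → x , ∈-facetOf x , X⊆F x x∈X , refl)
    where
    F = proj₁ (extendToFacet X sX)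
    X⊆F = proj₂ (extendToFacet X sX)

  ε-isSimpMap : IsSimpMap C (σ (κ C)) ε
  ε-isSimpMap = record
    { resp    = λ {u} {v} u≈v →
        χ-resp u≈v , u , ∈-facetOf u , ∈-resp-≈ setoid (≈-sym u≈v) (∈-facetOf v) , refl
    ; simplex = ε-simplex
    ; colour  = λ _ → refl
    }

  ε⁻¹ : RawSimpMap (σ (κ C)) C
  ε⁻¹ (_ , _ , v , _) = v

  ε⁻¹-InWorld : ∀ {F} x → SK.InWorld F x → ε⁻¹ x ∈ proj₁ F
  ε⁻¹-InWorld (_ , X , v , v∈X , _ , χv) (z , z∈X , z∈F , χz) =
    ∈-facet-colour X v∈X z∈X (≡-trans χv (≡-sym χz)) z∈F

  ε⁻¹-resp : ∀ {x y} → _≈_ (σ (κ C)) x y → _≈_ C (ε⁻¹ x) (ε⁻¹ y)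
  ε⁻¹-resp {x@(_ , _ , _ , _ , _ , χv)} {_ , Y , _ , w∈Y , _ , χw} (refl , x∈Y) =
    facet-chromatic Y (ε⁻¹-InWorld {Y} x x∈Y) w∈Y (≡-trans χv (≡-sym χw))

  ε⁻¹-simplex : ∀ {L} → Simplex (σ (κ C)) L → Simplex C (map ε⁻¹ L)
  ε⁻¹-simplex {L} (L≢[] , F , L∈F) = downward (proj₁ (proj₂ F)) (map-≢[] ε⁻¹ L≢[]) ε⁻¹L⊆F
    where
    ε⁻¹L⊆F : Sub (_≈_ C) (map ε⁻¹ L) (proj₁ F)
    ε⁻¹L⊆F y y∈ε⁻¹L with ∈-map⁻ SK.setoid setoid {y} {L} {ε⁻¹} y∈ε⁻¹L
    ... | x , x∈L , y≈ε⁻¹x =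
      ∈-resp-≈ setoid (≈-sym y≈ε⁻¹x) (ε⁻¹-InWorld {F} x (SK.InWorld-lookup {F} L∈F x x∈L))

  ε⁻¹-isSimpMap : IsSimpMap (σ (κ C)) C ε⁻¹
  ε⁻¹-isSimpMap = record
    { resp    = λ {x} {y} → ε⁻¹-resp {x} {y}
    ; simplex = ε⁻¹-simplex
    ; colour  = λ (_ , _ , _ , _ , _ , χv) → χv
    }

  ε-isIso : IsoCpx C (σ (κ C)) ε
  ε-isIso = ε-isSimpMap , ε⁻¹ , ε⁻¹-isSimpMap , (λ _ → ≈-refl) ,
    λ (_ , _ , v , _ , v∈X , χv) → χv , v , ∈-facetOf v , v∈X , refl

module _ {A : Set} (em : ExcludedMiddle 0ℓ)
         (agents : List A) (agents-enum : IsEnumeration (≡-setoid A) agents)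
         {C D : RawCpx A} (pC : IsCpx C) (pD : IsCpx D) {f : RawSimpMap C D} (fp : IsSimpMap C D f)
         (kp : IsFrameMap (κ C) (κ D) (κmap C D f)) where
  private
    module εC = Counit em agents agents-enum C pC
    module εD = Counit em agents agents-enum D pD

  ε-natural : EqS C (σ (κ D)) (compS C D (σ (κ D)) εD.ε f)
                (compS C (σ (κ C)) (σ (κ D)) (σmap (κ C) (κ D) (κmap C D f) kp) εC.ε)
  ε-natural v = IsSimpMap.colour fp v , f v , εD.∈-facetOf (f v) ,
    representative-∈ kp (εC.facetOf v) (f v) (∈-map-simpMap pC pD fp (εC.∈-facetOf v)) , refl

theorem25 : ExcludedMiddle 0ℓ → (n : ℕ) →
  ((C : RawCpx (Fin (suc n))) → IsCpx C → IsProperFrame (κ C)) ×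
  ((C D : RawCpx (Fin (suc n))) (f : RawSimpMap C D) → IsCpx C → IsCpx D →
    IsSimpMap C D f → IsFrameMap (κ C) (κ D) (κmap C D f)) ×
  ((M : RawFrame (Fin (suc n))) → IsProperFrame M → IsCpx (σ M)) ×
  ((M M' : RawFrame (Fin (suc n))) (h : RawFrameMap M M') → IsProperFrame M → IsProperFrame M' →
    (hp : IsFrameMap M M' h) → IsSimpMap (σ M) (σ M') (σmap M M' h hp)) ×
  Σ ((M : RawFrame (Fin (suc n))) → IsProperFrame M → RawFrameMap M (κ (σ M))) (λ η →
    ((M : RawFrame (Fin (suc n))) (pM : IsProperFrame M) → IsoFrame M (κ (σ M)) (η M pM)) ×
    ((M M' : RawFrame (Fin (suc n))) (pM : IsProperFrame M) (pM' : IsProperFrame M')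
      (h : RawFrameMap M M') (hp : IsFrameMap M M' h) →
      EqF M (κ (σ M'))
        (compF M M' (κ (σ M')) (η M' pM') h)
        (compF M (κ (σ M)) (κ (σ M')) (κmap (σ M) (σ M') (σmap M M' h hp)) (η M pM)))) ×
  Σ ((C : RawCpx (Fin (suc n))) → IsCpx C → RawSimpMap C (σ (κ C))) (λ ε →
    ((C : RawCpx (Fin (suc n))) (pC : IsCpx C) → IsoCpx C (σ (κ C)) (ε C pC)) ×
    ((C D : RawCpx (Fin (suc n))) (pC : IsCpx C) (pD : IsCpx D) (f : RawSimpMap C D) →
      IsSimpMap C D f → (kp : IsFrameMap (κ C) (κ D) (κmap C D f)) →
      EqS C (σ (κ D))
        (compS C D (σ (κ D)) (ε D pD) f)
        (compS C (σ (κ C)) (σ (κ D)) (σmap (κ C) (κ D) (κmap C D f) kp) (ε C pC))))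
theorem25 em n =
  (λ C pC → Complex.κ-isProper C pC em) ,
  (λ C D f pC pD fp → κmap-isFrameMap pC pD fp em agents ∈-allFin) ,
  (λ M pM → Sigma.σ-isCpx M pM) ,
  (λ M M' h pM pM' hp → σmap-isSimpMap pM pM' hp) ,
  ((λ M pM → graph M (κ (σ M)) (Unit.worldFacet em agents ∈-allFin M pM)) ,
   (λ M pM → Unit.worldFacet-isIso em agents ∈-allFin M pM) ,
   (λ M M' pM pM' h hp → worldFacet-natural em agents ∈-allFin pM pM' hp)) ,
  ((λ C pC → Counit.ε em agents ∈-allFin C pC) ,
   (λ C pC → Counit.ε-isIso em agents ∈-allFin C pC) ,
   (λ C D pC pD f fp kp → ε-natural em agents ∈-allFin pC pD fp kp))
  where
  agents = allFin (suc n)
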